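{- Let $k\ge 2$, let $H_0$ be a finite $k$-uniform hypergraph and $H_t=\mathrm{ILTH}_t(H_0)$. For each $t\ge 0$ let $A(t)$ be the set of 5-tuples $(u,e_1,v,e_2,w)$ such that $u,v,w\in V(H_t)$ are distinct, $e_1,e_2\in E(H_t)$ (not necessarily distinct), and there exists $e_3\in E(H_t)$ with $u\in e_1\cap e_3$, $v\in e_1\cap e_2$, $w\in e_2\cap e_3$. Then for all nonnegative integers $t$, $|A(t)|=(k^2)^t|A(0)|$.
   Context: ILTH model: given $H_t$, $H_{t+1}$ has vertex set $V(H_t)\cup\{x':x\in V(H_t)\}$ where each $x'$ is a new vertex (the clone of $x$), and hyperedge set $E(H_t)\cup\{(e\setminus\{x\})\cup\{x'\}: e\in E(H_t), x\in e\}$. -}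

module Defs where

open import Data.Nat using (ℕ; zero; suc; _+_)
open import Data.Fin using (Fin)
open import Data.Fin.Properties using () renaming (_≟_ to _≟ᶠ_)
open import Data.Fin.Subset using (Subset; inside; outside; ⁅_⁆; ∣_∣) renaming (_∈_ to _∈ₛ_; ⊥ to ∅)
open import Data.Fin.Subset.Properties using (_∈?_)
open import Data.Vec using (Vec; []; _∷_; _++_; _[_]≔_)
open import Data.Vec.Properties using (≡-dec)
open import Data.Bool.Properties using () renaming (_≟_ to _≟ᵇ_)
open import Data.List using (List; []; _∷_; [_]; map; filter; concatMap; allFin; cartesianProduct; length)
import Data.List as L
open import Data.List.Relation.Unary.All using (All)
open import Data.List.Relation.Unary.Any using (Any; any?)
open import Data.List.Membership.Propositional using (_∈_)
open import Data.Product using (_×_; _,_)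
open import Relation.Binary.PropositionalEquality using (_≡_)
open import Relation.Nullary using (¬_; Dec; _×-dec_; ¬?)
open import Relation.Unary using (Decidable)
open import Function using (id)

-- A finite hypergraph: vertex set Fin n, edge set = the set of subsets
-- occurring in the list `edges` (duplicates in the list are irrelevant,
-- all notions below only use list membership).
record Hypergraph : Set where
  constructor hg
  field
    n     : ℕ
    edges : List (Subset n)
open Hypergraph public

Uniform : ℕ → Hypergraph → Set
Uniform k H = All (λ e → ∣ e ∣ ≡ k) (edges H)

members : ∀ {n} → Subset n → List (Fin n)
members e = filter (λ x → x ∈? e) (allFin _)

-- V(H') = Fin (n + n): the first n vertices (inject+) are
-- the old vertices, vertex  n + x  (raise n x) is the clone x' of x.
-- Old edge e becomes e ++ ∅ ; the edge (e \ {x}) ∪ {x'} is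
-- (e [ x ]≔ outside) ++ ⁅ x ⁆.
ILTH-step : Hypergraph → Hypergraph
ILTH-step (hg n E) = hg (n + n)
  (map (λ e → e ++ ∅) E L.++
   concatMap (λ e → map (λ x → (e [ x ]≔ outside) ++ ⁅ x ⁆) (members e)) E)

ILTH : ℕ → Hypergraph → Hypergraph
ILTH zero    H = H
ILTH (suc t) H = ILTH-step (ILTH t H)

allSubsets : ∀ n → List (Subset n)
allSubsets zero    = [ [] ]
allSubsets (suc n) = concatMap (λ s → (outside ∷ s) ∷ (inside ∷ s) ∷ []) (allSubsets n)

_∈E?_ : ∀ {n} (e : Subset n) (E : List (Subset n)) → Dec (e ∈ E)
e ∈E? E = any? (λ e′ → ≡-dec _≟ᵇ_ e e′) E

Tuple : ℕ → Set
Tuple n = Fin n × Subset n × Fin n × Subset n × Fin n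

allTuples : ∀ n → List (Tuple n)
allTuples n = cartesianProduct (allFin n) (cartesianProduct (allSubsets n)
               (cartesianProduct (allFin n) (cartesianProduct (allSubsets n) (allFin n))))

InA : (H : Hypergraph) → Tuple (n H) → Set
InA H (u , e₁ , v , e₂ , w) =
  ¬ u ≡ v × ¬ v ≡ w × ¬ u ≡ w ×
  e₁ ∈ edges H × e₂ ∈ edges H ×
  u ∈ₛ e₁ × v ∈ₛ e₁ × v ∈ₛ e₂ × w ∈ₛ e₂ ×
  Any (λ e₃ → u ∈ₛ e₃ × w ∈ₛ e₃) (edges H)

InA? : (H : Hypergraph) → Decidable (InA H)
InA? H (u , e₁ , v , e₂ , w) =
  ¬? (u ≟ᶠ v) ×-dec ¬? (v ≟ᶠ w) ×-dec ¬? (u ≟ᶠ w) ×-dec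
  (e₁ ∈E? edges H) ×-dec (e₂ ∈E? edges H) ×-dec
  (u ∈? e₁) ×-dec (v ∈? e₁) ×-dec (v ∈? e₂) ×-dec (w ∈? e₂) ×-dec
  any? (λ e₃ → (u ∈? e₃) ×-dec (w ∈? e₃)) (edges H)

-- the set A(H) as a list (each element once), and its cardinality |A(H)|
A : (H : Hypergraph) → List (Tuple (n H))
A H = filter (InA? H) (allTuples (n H))

∣A∣ : Hypergraph → ℕ
∣A∣ H = length (A H)

-- Collapsing every clone x′ onto x maps the vertices of ILTH-step H onto those of H and
-- each edge onto an edge: the copy of e and every clone edge (e ∖ {x}) ∪ {x′} collapse to e.
-- No edge contains both x and x′, nor two clones, so the collapse maps A(ILTH-step H) into
-- A(H). Over (u, e₁, v, e₂, w) ∈ A(H) lie the tuples in which at most one of u, v, w is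
-- replaced by its clone. With no clone, e₁ may be lifted to its copy or to the clone edge
-- at any of its k − 2 vertices other than u, v, and likewise e₂: (k − 1)² lifts. Cloning u
-- (or w) forces the lift of e₁ (or e₂), giving k − 1 each; cloning v forces both. So every
-- fibre has (k − 1)² + 2(k − 1) + 1 = k² elements, and uniformity is inherited.

module Submission where

open import Defs hiding (n)
open import Data.Nat.Base using (ℕ; zero; suc; _+_; _*_; _^_; _≤_)
open import Data.Nat.ListAction using (sum)
open import Data.Nat.Properties using (+-identityʳ; +-comm; *-comm; *-assoc; *-identityˡ)
open import Data.Nat.Tactic.RingSolver using (solve-∀)
open import Data.Empty using (⊥-elim)
open import Data.Fin.Base using (Fin; zero; suc; _↑ˡ_; _↑ʳ_; splitAt)
open import Data.Fin.Properties using (suc-injective; splitAt-↑ˡ; splitAt-↑ʳ; splitAt⁻¹-↑ˡ; splitAt⁻¹-↑ʳ)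
open import Data.Fin.Subset using (Subset; inside; outside; ⁅_⁆; ∣_∣; _∪_)
  renaming (_∈_ to _∈ₛ_; _∉_ to _∉ₛ_; ⊥ to ∅)
open import Data.Fin.Subset.Properties
  using (_∈?_; x∈⁅x⁆; x∈⁅y⁆⇒x≡y; ∉⊥; ∪-identityʳ; ∣⊥∣≡0; ∣⁅x⁆∣≡1; drop-there)
open import Data.Vec.Base as Vec using ([]; _∷_; _++_; _[_]≔_; here; there)
open import Data.Vec.Properties using ([]≔-minimal; ++-injective; take++drop≡id)
open import Data.List.Base
  using (List; []; _∷_; [_]; map; filter; concat; concatMap; tabulate; allFin; cartesianProduct; length)
open import Data.List.Properties using (length-++; length-map; filter-accept; filter-reject)
open import Data.List.Relation.Unary.All as All using (All; []; _∷_)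
open import Data.List.Relation.Unary.All.Properties using (¬Any⇒All¬)
open import Data.List.Relation.Unary.AllPairs using ([]; _∷_)
open import Data.List.Relation.Unary.Any using (Any; here; there)
open import Data.List.Membership.Propositional using (_∈_; _∉_; find; lose)
open import Data.List.Membership.Propositional.Properties
  using ( ∈-map⁺; ∈-map⁻; ∈-++⁺ˡ; ∈-++⁺ʳ; ∈-++⁻; ∈-concat⁺; ∈-concat⁻; ∈-concatMap⁺; ∈-concatMap⁻
        ; ∈-filter⁺; ∈-filter⁻; ∈-allFin; ∈-cartesianProduct⁺; ∈-cartesianProduct⁻)
open import Data.List.Membership.Propositional.Properties.WithK using (unique∧set⇒bag)
open import Data.List.Relation.Binary.BagAndSetEquality using (∼bag⇒↭)
open import Data.List.Relation.Binary.Disjoint.Propositional using (Disjoint)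
open import Data.List.Relation.Binary.Permutation.Propositional using (_↭_)
open import Data.List.Relation.Binary.Permutation.Propositional.Properties using (↭-length)
open import Data.List.Relation.Unary.Unique.Propositional using (Unique)
import Data.List.Relation.Unary.Unique.Propositional.Properties as Unique
open import Data.Product.Base using (_×_; _,_; proj₁; proj₂; ∃₂; ∃-syntax)
open import Data.Sum.Base using (inj₁; inj₂; [_,_]′)
open import Function.Base using (id; _∘_)
open import Function.Bundles using (mk⇔)
open import Level using (0ℓ)
open import Relation.Binary.PropositionalEquality
  using (_≡_; _≢_; refl; sym; trans; cong; cong₂; subst; ≢-sym; module ≡-Reasoning)
open import Relation.Nullary.Negation using (¬_)
open import Relation.Unary using (Pred; Decidable)

private
  variable
    X Y : Set
    m n : ℕ

concatMap-unique : (g : Y → X) {f : X → List Y} {xs : List X} → Unique xs →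
                   (∀ {x} → x ∈ xs → Unique (f x)) →
                   (∀ {x b} → x ∈ xs → b ∈ f x → g b ≡ x) →
                   Unique (concatMap f xs)
concatMap-unique g {xs = []}     []          _        _      = []
concatMap-unique g {f} {x ∷ xs} (x∉xs ∷ !xs) !f over =
  Unique.++⁺ (!f (here refl)) (concatMap-unique g !xs (!f ∘ there) (over ∘ there)) disjoint
  where
  disjoint : ∀ {b} → ¬ (b ∈ f x × b ∈ concatMap f xs)
  disjoint (b∈fx , b∈rest) with find (∈-concatMap⁻ f {xs = xs} b∈rest)
  ... | y , y∈xs , b∈fy =
    All.lookup x∉xs y∈xs (trans (sym (over (here refl) b∈fx)) (over (there y∈xs) b∈fy))

length-concatMap-const : ∀ {f : X → List Y} c (xs : List X) → All (λ x → length (f x) ≡ c) xs →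
                         length (concatMap f xs) ≡ length xs * c
length-concatMap-const c []       []       = refl
length-concatMap-const {f = f} c (x ∷ xs) (fx≡c ∷ fxs≡c) =
  trans (length-++ (f x)) (cong₂ _+_ fx≡c (length-concatMap-const c xs fxs≡c))

length-cartesianProduct : (xs : List X) (ys : List Y) →
                          length (cartesianProduct xs ys) ≡ length xs * length ys
length-cartesianProduct []       ys = refl
length-cartesianProduct (x ∷ xs) ys =
  trans (length-++ (map (x ,_) ys)) (cong₂ _+_ (length-map (x ,_) ys) (length-cartesianProduct xs ys))

length-concat : (xss : List (List X)) → length (concat xss) ≡ sum (map length xss)
length-concat []         = refl
length-concat (xs ∷ xss) = trans (length-++ xs) (cong (length xs +_) (length-concat xss))

length-filter-tabulate : ∀ {P : Pred X 0ℓ} (P? : Decidable P) (g : Fin n → X) (p : Subset n) →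
                         (∀ i → P (g i) → i ∈ₛ p) → (∀ i → i ∈ₛ p → P (g i)) →
                         length (filter P? (tabulate g)) ≡ ∣ p ∣
length-filter-tabulate P? g []            _     _     = refl
length-filter-tabulate P? g (inside ∷ p)  sound compl =
  trans (cong length (filter-accept P? (compl zero here)))
        (cong suc (length-filter-tabulate P? (g ∘ suc) p (λ i → drop-there ∘ sound (suc i))
                                                         (λ i → compl (suc i) ∘ there)))
length-filter-tabulate P? g (outside ∷ p) sound compl =
  trans (cong length (filter-reject P? (zero∉ ∘ sound zero)))
        (length-filter-tabulate P? (g ∘ suc) p (λ i → drop-there ∘ sound (suc i))
                                               (λ i → compl (suc i) ∘ there))
  where
  zero∉ : ¬ (zero ∈ₛ outside ∷ p)
  zero∉ ()

↑ˡ∈++⁺ : ∀ {x} {p : Subset m} {q : Subset n} → x ∈ₛ p → x ↑ˡ n ∈ₛ p ++ q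
↑ˡ∈++⁺ here      = here
↑ˡ∈++⁺ (there x) = there (↑ˡ∈++⁺ x)

↑ˡ∈++⁻ : ∀ {x} (p : Subset m) {q : Subset n} → x ↑ˡ n ∈ₛ p ++ q → x ∈ₛ p
↑ˡ∈++⁻ {x = zero}  (_ ∷ p) here      = here
↑ˡ∈++⁻ {x = suc x} (_ ∷ p) (there x∈) = there (↑ˡ∈++⁻ p x∈)

↑ʳ∈++⁺ : ∀ {x} (p : Subset m) {q : Subset n} → x ∈ₛ q → m ↑ʳ x ∈ₛ p ++ q
↑ʳ∈++⁺ []      x∈ = x∈
↑ʳ∈++⁺ (_ ∷ p) x∈ = there (↑ʳ∈++⁺ p x∈)

↑ʳ∈++⁻ : ∀ {x} (p : Subset m) {q : Subset n} → m ↑ʳ x ∈ₛ p ++ q → x ∈ₛ q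
↑ʳ∈++⁻ []      x∈         = x∈
↑ʳ∈++⁻ (_ ∷ p) (there x∈) = ↑ʳ∈++⁻ p x∈

x∈p[y]≔outside⁺ : ∀ {x y} {p : Subset n} → x ∈ₛ p → x ≢ y → x ∈ₛ p [ y ]≔ outside
x∈p[y]≔outside⁺ {x = x} {y} {p} x∈p x≢y = []≔-minimal p x y x≢y x∈p

x∈p[y]≔outside⁻ : ∀ {x y} (p : Subset n) → x ∈ₛ p [ y ]≔ outside → x ∈ₛ p × x ≢ y
x∈p[y]≔outside⁻ {y = zero}  (_ ∷ p) (there x∈) = there x∈ , λ ()
x∈p[y]≔outside⁻ {y = suc y} (_ ∷ p) here       = here , λ ()
x∈p[y]≔outside⁻ {y = suc y} (_ ∷ p) (there x∈) =
  let x∈p , x≢y = x∈p[y]≔outside⁻ p x∈ in there x∈p , x≢y ∘ suc-injective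

∣p++q∣≡∣p∣+∣q∣ : (p : Subset m) (q : Subset n) → ∣ p ++ q ∣ ≡ ∣ p ∣ + ∣ q ∣
∣p++q∣≡∣p∣+∣q∣ []            q = refl
∣p++q∣≡∣p∣+∣q∣ (inside  ∷ p) q = cong suc (∣p++q∣≡∣p∣+∣q∣ p q)
∣p++q∣≡∣p∣+∣q∣ (outside ∷ p) q = ∣p++q∣≡∣p∣+∣q∣ p q

x∈p⇒suc∣p[x]≔outside∣≡∣p∣ : ∀ {x} (p : Subset n) → x ∈ₛ p → suc ∣ p [ x ]≔ outside ∣ ≡ ∣ p ∣
x∈p⇒suc∣p[x]≔outside∣≡∣p∣ (inside  ∷ p) here       = refl
x∈p⇒suc∣p[x]≔outside∣≡∣p∣ (inside  ∷ p) (there x∈) = cong suc (x∈p⇒suc∣p[x]≔outside∣≡∣p∣ p x∈)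
x∈p⇒suc∣p[x]≔outside∣≡∣p∣ (outside ∷ p) (there x∈) = x∈p⇒suc∣p[x]≔outside∣≡∣p∣ p x∈

x∈p⇒p[x]≔outside∪⁅x⁆≡p : ∀ {x} (p : Subset n) → x ∈ₛ p → (p [ x ]≔ outside) ∪ ⁅ x ⁆ ≡ p
x∈p⇒p[x]≔outside∪⁅x⁆≡p (inside  ∷ p) here       = cong (inside ∷_) (∪-identityʳ p)
x∈p⇒p[x]≔outside∪⁅x⁆≡p (inside  ∷ p) (there x∈) = cong (inside ∷_) (x∈p⇒p[x]≔outside∪⁅x⁆≡p p x∈)
x∈p⇒p[x]≔outside∪⁅x⁆≡p (outside ∷ p) (there x∈) = cong (outside ∷_) (x∈p⇒p[x]≔outside∪⁅x⁆≡p p x∈)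

∈-members⁺ : ∀ {x} {p : Subset n} → x ∈ₛ p → x ∈ members p
∈-members⁺ {x = x} {p} = ∈-filter⁺ (_∈? p) (∈-allFin x)

∈-members⁻ : ∀ {x} {p : Subset n} → x ∈ members p → x ∈ₛ p
∈-members⁻ {n} {p = p} = proj₂ ∘ ∈-filter⁻ (_∈? p) {xs = allFin n}

members-unique : (p : Subset n) → Unique (members p)
members-unique {n} p = Unique.filter⁺ (_∈? p) (Unique.allFin⁺ n)

length-members : (p : Subset n) → length (members p) ≡ ∣ p ∣
length-members p = length-filter-tabulate (_∈? p) (λ i → i) p (λ _ x∈ → x∈) (λ _ x∈ → x∈)

∈-allSubsets : (p : Subset n) → p ∈ allSubsets n
∈-allSubsets []            = here refl
∈-allSubsets (outside ∷ p) = ∈-concatMap⁺ _ (lose (∈-allSubsets p) (here refl))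
∈-allSubsets (inside  ∷ p) = ∈-concatMap⁺ _ (lose (∈-allSubsets p) (there (here refl)))

allSubsets-unique : ∀ n → Unique (allSubsets n)
allSubsets-unique zero    = [] ∷ []
allSubsets-unique (suc n) =
  concatMap-unique Vec.tail (allSubsets-unique n) (λ _ → ((λ ()) ∷ []) ∷ [] ∷ []) tail-fibre
  where
  tail-fibre : ∀ {p q} → p ∈ allSubsets n → q ∈ (outside ∷ p) ∷ (inside ∷ p) ∷ [] → Vec.tail q ≡ p
  tail-fibre _ (here refl)         = refl
  tail-fibre _ (there (here refl)) = refl

vertices : Tuple m → Fin m × Fin m × Fin m
vertices (u , _ , v , _ , w) = u , v , w

edgePair : Tuple m → Subset m × Subset m
edgePair (_ , e₁ , _ , e₂ , _) = e₁ , e₂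

∈-allTuples : (x : Tuple n) → x ∈ allTuples n
∈-allTuples (u , e₁ , v , e₂ , w) =
  ∈-cartesianProduct⁺ (∈-allFin u) (∈-cartesianProduct⁺ (∈-allSubsets e₁)
    (∈-cartesianProduct⁺ (∈-allFin v) (∈-cartesianProduct⁺ (∈-allSubsets e₂) (∈-allFin w))))

allTuples-unique : ∀ n → Unique (allTuples n)
allTuples-unique n =
  Unique.cartesianProduct⁺ (Unique.allFin⁺ n) (Unique.cartesianProduct⁺ (allSubsets-unique n)
    (Unique.cartesianProduct⁺ (Unique.allFin⁺ n)
      (Unique.cartesianProduct⁺ (allSubsets-unique n) (Unique.allFin⁺ n))))

Distinct : Tuple m → Set
Distinct (u , _ , v , _ , w) = u ≢ v × v ≢ w × u ≢ w

Triangle : List (Subset m) → Tuple m → Set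
Triangle E (u , e₁ , v , e₂ , w) =
  e₁ ∈ E × e₂ ∈ E × u ∈ₛ e₁ × v ∈ₛ e₁ × v ∈ₛ e₂ × w ∈ₛ e₂ × Any (λ e₃ → u ∈ₛ e₃ × w ∈ₛ e₃) E

InA⁺ : (H : Hypergraph) (y : Tuple (Hypergraph.n H)) → Distinct y → Triangle (edges H) y → InA H y
InA⁺ H (u , e₁ , v , e₂ , w) (u≢v , v≢w , u≢w) triangle = u≢v , v≢w , u≢w , triangle

∈-A⁺ : ∀ H {x} → InA H x → x ∈ A H
∈-A⁺ H {x} = ∈-filter⁺ (InA? H) (∈-allTuples x)

∈-A⁻ : ∀ H {x} → x ∈ A H → InA H x
∈-A⁻ H = proj₂ ∘ ∈-filter⁻ (InA? H) {xs = allTuples _}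

A-unique : ∀ H → Unique (A H)
A-unique H = Unique.filter⁺ (InA? H) (allTuples-unique _)

-- Opaque: over singleton edge lists it would compute away and its arguments could not be inferred.
opaque
  tuplesOn : Fin m × Fin m × Fin m → List (Subset m) → List (Subset m) → List (Tuple m)
  tuplesOn (u , v , w) F₁ F₂ = map (λ (f₁ , f₂) → u , f₁ , v , f₂ , w) (cartesianProduct F₁ F₂)

  ∈-tuplesOn⁺ : ∀ {u v w f₁ f₂} {F₁ F₂ : List (Subset m)} → f₁ ∈ F₁ → f₂ ∈ F₂ →
                (u , f₁ , v , f₂ , w) ∈ tuplesOn (u , v , w) F₁ F₂
  ∈-tuplesOn⁺ f₁∈ f₂∈ = ∈-map⁺ _ (∈-cartesianProduct⁺ f₁∈ f₂∈)

  ∈-tuplesOn⁻ : ∀ {x} u v w (F₁ F₂ : List (Subset m)) → x ∈ tuplesOn (u , v , w) F₁ F₂ →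
                ∃₂ λ f₁ f₂ → f₁ ∈ F₁ × f₂ ∈ F₂ × x ≡ (u , f₁ , v , f₂ , w)
  ∈-tuplesOn⁻ u v w F₁ F₂ x∈ =
    let (f₁ , f₂) , f∈ , x≡ = ∈-map⁻ _ x∈
        f₁∈ , f₂∈ = ∈-cartesianProduct⁻ F₁ F₂ f∈
    in f₁ , f₂ , f₁∈ , f₂∈ , x≡

  tuplesOn-unique : ∀ t {F₁ F₂ : List (Subset m)} → Unique F₁ → Unique F₂ → Unique (tuplesOn t F₁ F₂)
  tuplesOn-unique t !F₁ !F₂ = Unique.map⁺ (cong edgePair) (Unique.cartesianProduct⁺ !F₁ !F₂)

  tuplesOn-disjoint : ∀ {t t′} {F₁ F₂ F₁′ F₂′ : List (Subset m)} → t ≢ t′ →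
                      Disjoint (tuplesOn t F₁ F₂) (tuplesOn t′ F₁′ F₂′)
  tuplesOn-disjoint {t = u , v , w} {u′ , v′ , w′} {F₁} {F₂} {F₁′} {F₂′} t≢t′ (x∈ , x∈′) =
    let _ , _ , _ , _ , x≡  = ∈-tuplesOn⁻ u v w F₁ F₂ x∈
        _ , _ , _ , _ , x≡′ = ∈-tuplesOn⁻ u′ v′ w′ F₁′ F₂′ x∈′
    in t≢t′ (cong vertices (trans (sym x≡) x≡′))

  length-tuplesOn : ∀ t (F₁ F₂ : List (Subset m)) → length (tuplesOn t F₁ F₂) ≡ length F₁ * length F₂
  length-tuplesOn t F₁ F₂ = trans (length-map _ (cartesianProduct F₁ F₂)) (length-cartesianProduct F₁ F₂)

-- Clones, and the collapse of a clone onto its original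

module CloneStep (n : ℕ) where

  private
    variable
      a b u v w : Fin n
      e e₁ e₂ : Subset n
      f f₁ f₂ : Subset (n + n)

  old clone : Fin n → Fin (n + n)
  old   a = a ↑ˡ n
  clone a = n ↑ʳ a

  collapse : Fin (n + n) → Fin n
  collapse z = [ id , id ]′ (splitAt n z)

  data Origin : Fin (n + n) → Fin n → Set where
    is-old   : ∀ a → Origin (old a) a
    is-clone : ∀ a → Origin (clone a) a

  origin : ∀ z → Origin z (collapse z)
  origin z with splitAt n z in eq
  ... | inj₁ a with refl ← splitAt⁻¹-↑ˡ eq = is-old a
  ... | inj₂ a with refl ← splitAt⁻¹-↑ʳ eq = is-clone a

  collapse-old : ∀ a → collapse (old a) ≡ a
  collapse-old a = cong [ id , id ]′ (splitAt-↑ˡ n a n)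

  collapse-clone : ∀ a → collapse (clone a) ≡ a
  collapse-clone a = cong [ id , id ]′ (splitAt-↑ʳ n n a)

  old≢clone : old a ≢ clone b
  old≢clone {a} {b} eq
    with () ← trans (sym (splitAt-↑ˡ n a n)) (trans (cong (splitAt n) eq) (splitAt-↑ʳ n n b))

  oldEdge : Subset n → Subset (n + n)
  oldEdge e = e ++ ∅

  cloneEdge : Subset n → Fin n → Subset (n + n)
  cloneEdge e a = (e [ a ]≔ outside) ++ ⁅ a ⁆

  collapseEdge : Subset (n + n) → Subset n
  collapseEdge f = Vec.take n f ∪ Vec.drop n f

  collapseEdge-++ : (p q : Subset n) → collapseEdge (p ++ q) ≡ p ∪ q
  collapseEdge-++ p q =
    let take≡p , drop≡q = ++-injective (Vec.take n (p ++ q)) p (take++drop≡id n (p ++ q))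
    in cong₂ _∪_ take≡p drop≡q

  old∈oldEdge : a ∈ₛ e → old a ∈ₛ oldEdge e
  old∈oldEdge = ↑ˡ∈++⁺

  clone∉oldEdge : clone a ∉ₛ oldEdge e
  clone∉oldEdge {e = e} = ∉⊥ ∘ ↑ʳ∈++⁻ e

  old∈cloneEdge⁺ : b ∈ₛ e → b ≢ a → old b ∈ₛ cloneEdge e a
  old∈cloneEdge⁺ b∈e b≢a = ↑ˡ∈++⁺ (x∈p[y]≔outside⁺ b∈e b≢a)

  old∈cloneEdge⁻ : old b ∈ₛ cloneEdge e a → b ∈ₛ e × b ≢ a
  old∈cloneEdge⁻ {e = e} = x∈p[y]≔outside⁻ e ∘ ↑ˡ∈++⁻ _

  clone∈cloneEdge : clone a ∈ₛ cloneEdge e a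
  clone∈cloneEdge {a = a} {e} = ↑ʳ∈++⁺ (e [ a ]≔ outside) (x∈⁅x⁆ a)

  clone∈cloneEdge⁻ : clone b ∈ₛ cloneEdge e a → b ≡ a
  clone∈cloneEdge⁻ {a = a} = x∈⁅y⁆⇒x≡y a ∘ ↑ʳ∈++⁻ _

  data EdgeOver (e : Subset n) : Subset (n + n) → Set where
    is-old   : EdgeOver e (oldEdge e)
    is-clone : a ∈ₛ e → EdgeOver e (cloneEdge e a)

  collapseEdge-over : EdgeOver e f → collapseEdge f ≡ e
  collapseEdge-over {e} is-old                 = trans (collapseEdge-++ e ∅) (∪-identityʳ e)
  collapseEdge-over {e} (is-clone {a = a} a∈e) =
    trans (collapseEdge-++ (e [ a ]≔ outside) ⁅ a ⁆) (x∈p⇒p[x]≔outside∪⁅x⁆≡p e a∈e)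

  ∣over∣≡∣e∣ : EdgeOver e f → ∣ f ∣ ≡ ∣ e ∣
  ∣over∣≡∣e∣ {e} is-old = begin
    ∣ oldEdge e ∣      ≡⟨ ∣p++q∣≡∣p∣+∣q∣ e ∅ ⟩
    ∣ e ∣ + ∣ ∅ {n} ∣  ≡⟨ cong (∣ e ∣ +_) (∣⊥∣≡0 n) ⟩
    ∣ e ∣ + 0          ≡⟨ +-identityʳ ∣ e ∣ ⟩
    ∣ e ∣              ∎
    where open ≡-Reasoning
  ∣over∣≡∣e∣ {e} (is-clone {a = a} a∈e) = begin
    ∣ cloneEdge e a ∣                    ≡⟨ ∣p++q∣≡∣p∣+∣q∣ (e [ a ]≔ outside) ⁅ a ⁆ ⟩
    ∣ e [ a ]≔ outside ∣ + ∣ ⁅ a ⁆ ∣    ≡⟨ cong (∣ e [ a ]≔ outside ∣ +_) (∣⁅x⁆∣≡1 a) ⟩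
    ∣ e [ a ]≔ outside ∣ + 1             ≡⟨ +-comm _ 1 ⟩
    suc ∣ e [ a ]≔ outside ∣             ≡⟨ x∈p⇒suc∣p[x]≔outside∣≡∣p∣ e a∈e ⟩
    ∣ e ∣                                ∎
    where open ≡-Reasoning

  collapse-∈-over : EdgeOver e f → ∀ z → z ∈ₛ f → collapse z ∈ₛ e
  collapse-∈-over ov z z∈f with collapse z | origin z
  collapse-∈-over is-old             _ z∈f | _ | is-old a   = ↑ˡ∈++⁻ _ z∈f
  collapse-∈-over is-old             _ z∈f | _ | is-clone a = ⊥-elim (clone∉oldEdge z∈f)
  collapse-∈-over (is-clone _)       _ z∈f | _ | is-old a   = proj₁ (old∈cloneEdge⁻ z∈f)
  collapse-∈-over (is-clone {b} b∈e) _ z∈f | _ | is-clone a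
    with refl ← clone∈cloneEdge⁻ {a = b} z∈f = b∈e

  clone∈⇒≡cloneEdge : EdgeOver e f → clone a ∈ₛ f → f ≡ cloneEdge e a
  clone∈⇒≡cloneEdge is-old           a∈f = ⊥-elim (clone∉oldEdge a∈f)
  clone∈⇒≡cloneEdge (is-clone {b} _) a∈f with refl ← clone∈cloneEdge⁻ {a = b} a∈f = refl

  old∈⇒clone∉ : EdgeOver e f → old a ∈ₛ f → clone a ∉ₛ f
  old∈⇒clone∉ ov old∈f clone∈f with refl ← clone∈⇒≡cloneEdge ov clone∈f =
    proj₂ (old∈cloneEdge⁻ old∈f) refl

  edgeFibre : Subset n → Fin n → Fin n → List (Subset (n + n))
  edgeFibre e u v = oldEdge e ∷ map (cloneEdge e) (members ((e [ u ]≔ outside) [ v ]≔ outside))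

  edgeFibre⁺ : EdgeOver e f → old u ∈ₛ f → old v ∈ₛ f → f ∈ edgeFibre e u v
  edgeFibre⁺ is-old                   _   _   = here refl
  edgeFibre⁺ {e} (is-clone {a = a} a∈e) u∈f v∈f =
    there (∈-map⁺ (cloneEdge e) (∈-members⁺ (x∈p[y]≔outside⁺ (x∈p[y]≔outside⁺ a∈e a≢u) a≢v)))
    where
    a≢u = ≢-sym (proj₂ (old∈cloneEdge⁻ u∈f))
    a≢v = ≢-sym (proj₂ (old∈cloneEdge⁻ v∈f))

  edgeFibre⁻ : u ∈ₛ e → v ∈ₛ e → f ∈ edgeFibre e u v → EdgeOver e f × old u ∈ₛ f × old v ∈ₛ f
  edgeFibre⁻ u∈e v∈e (here refl) = is-old , old∈oldEdge u∈e , old∈oldEdge v∈e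
  edgeFibre⁻ {e = e} u∈e v∈e (there f∈) with ∈-map⁻ (cloneEdge e) f∈
  ... | a , a∈ , refl =
    let a∈e[u]≔o , a≢v = x∈p[y]≔outside⁻ _ (∈-members⁻ a∈)
        a∈e , a≢u = x∈p[y]≔outside⁻ e a∈e[u]≔o
    in is-clone a∈e , old∈cloneEdge⁺ u∈e (≢-sym a≢u) , old∈cloneEdge⁺ v∈e (≢-sym a≢v)

  cloneEdge-injective : cloneEdge e a ≡ cloneEdge e b → a ≡ b
  cloneEdge-injective {a = a} eq = clone∈cloneEdge⁻ (subst (clone a ∈ₛ_) eq clone∈cloneEdge)

  edgeFibre-unique : ∀ e u v → Unique (edgeFibre e u v)
  edgeFibre-unique e u v = ¬Any⇒All¬ _ oldEdge∉ ∷ Unique.map⁺ cloneEdge-injective (members-unique _)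
    where
    oldEdge∉ : oldEdge e ∉ map (cloneEdge e) (members ((e [ u ]≔ outside) [ v ]≔ outside))
    oldEdge∉ p = let a , _ , eq = ∈-map⁻ (cloneEdge e) p in
      clone∉oldEdge (subst (clone a ∈ₛ_) (sym eq) clone∈cloneEdge)

  length-edgeFibre : u ∈ₛ e → v ∈ₛ e → u ≢ v → suc (length (edgeFibre e u v)) ≡ ∣ e ∣
  length-edgeFibre {u} {e} {v} u∈e v∈e u≢v = begin
    2 + length (map (cloneEdge e) (members e-u-v))  ≡⟨ cong (2 +_) (length-map (cloneEdge e) (members e-u-v)) ⟩
    2 + length (members e-u-v)                      ≡⟨ cong (2 +_) (length-members e-u-v) ⟩
    2 + ∣ e-u-v ∣                                   ≡⟨ cong suc (x∈p⇒suc∣p[x]≔outside∣≡∣p∣ _ v∈e-u) ⟩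
    suc ∣ e [ u ]≔ outside ∣                        ≡⟨ x∈p⇒suc∣p[x]≔outside∣≡∣p∣ e u∈e ⟩
    ∣ e ∣                                           ∎
    where
    open ≡-Reasoning
    e-u-v = (e [ u ]≔ outside) [ v ]≔ outside
    v∈e-u = x∈p[y]≔outside⁺ v∈e (≢-sym u≢v)

  collapseTuple : Tuple (n + n) → Tuple n
  collapseTuple (u , f₁ , v , f₂ , w) =
    collapse u , collapseEdge f₁ , collapse v , collapseEdge f₂ , collapse w

  Distinct-collapse⁻ : ∀ x → Distinct (collapseTuple x) → Distinct x
  Distinct-collapse⁻ _ (u≢v , v≢w , u≢w) =
    u≢v ∘ cong collapse , v≢w ∘ cong collapse , u≢w ∘ cong collapse

  data FibreView : Tuple n → Tuple (n + n) → Set where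
    no-clone : f₁ ∈ edgeFibre e₁ u v → f₂ ∈ edgeFibre e₂ v w →
               FibreView (u , e₁ , v , e₂ , w) (old u , f₁ , old v , f₂ , old w)
    clone-u  : f₁ ≡ cloneEdge e₁ u → f₂ ∈ edgeFibre e₂ v w →
               FibreView (u , e₁ , v , e₂ , w) (clone u , f₁ , old v , f₂ , old w)
    clone-w  : f₁ ∈ edgeFibre e₁ u v → f₂ ≡ cloneEdge e₂ w →
               FibreView (u , e₁ , v , e₂ , w) (old u , f₁ , old v , f₂ , clone w)
    clone-v  : f₁ ≡ cloneEdge e₁ v → f₂ ≡ cloneEdge e₂ v →
               FibreView (u , e₁ , v , e₂ , w) (old u , f₁ , clone v , f₂ , old w)

  fibreBlocks : Tuple n → List (List (Tuple (n + n)))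
  fibreBlocks (u , e₁ , v , e₂ , w) =
      tuplesOn (old u   , old v   , old w)   (edgeFibre e₁ u v)   (edgeFibre e₂ v w)
    ∷ tuplesOn (clone u , old v   , old w)   [ cloneEdge e₁ u ]   (edgeFibre e₂ v w)
    ∷ tuplesOn (old u   , old v   , clone w) (edgeFibre e₁ u v)   [ cloneEdge e₂ w ]
    ∷ tuplesOn (old u   , clone v , old w)   [ cloneEdge e₁ v ]   [ cloneEdge e₂ v ]
    ∷ []

  fibre : Tuple n → List (Tuple (n + n))
  fibre y = concat (fibreBlocks y)

  fibre⁺ : ∀ {y x} → FibreView y x → x ∈ fibre y
  fibre⁺ {y} view = ∈-concat⁺ {xss = fibreBlocks y} (inBlock view)
    where
    inBlock : ∀ {y x} → FibreView y x → Any (x ∈_) (fibreBlocks y)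
    inBlock (no-clone f₁∈ f₂∈)  = here (∈-tuplesOn⁺ f₁∈ f₂∈)
    inBlock (clone-u refl f₂∈)  = there (here (∈-tuplesOn⁺ (here refl) f₂∈))
    inBlock (clone-w f₁∈ refl)  = there (there (here (∈-tuplesOn⁺ f₁∈ (here refl))))
    inBlock (clone-v refl refl) = there (there (there (here (∈-tuplesOn⁺ (here refl) (here refl)))))

  fibre⁻ : ∀ y {x} → x ∈ fibre y → FibreView y x
  fibre⁻ y x∈ with ∈-concat⁻ (fibreBlocks y) x∈
  fibre⁻ (u , e₁ , v , e₂ , w) _ | here x∈
    with _ , _ , f₁∈ , f₂∈ , refl ←
           ∈-tuplesOn⁻ (old u) (old v) (old w) (edgeFibre e₁ u v) (edgeFibre e₂ v w) x∈
    = no-clone f₁∈ f₂∈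
  fibre⁻ (u , e₁ , v , e₂ , w) _ | there (here x∈)
    with _ , _ , here refl , f₂∈ , refl ←
           ∈-tuplesOn⁻ (clone u) (old v) (old w) [ cloneEdge e₁ u ] (edgeFibre e₂ v w) x∈
    = clone-u refl f₂∈
  fibre⁻ (u , e₁ , v , e₂ , w) _ | there (there (here x∈))
    with _ , _ , f₁∈ , here refl , refl ←
           ∈-tuplesOn⁻ (old u) (old v) (clone w) (edgeFibre e₁ u v) [ cloneEdge e₂ w ] x∈
    = clone-w f₁∈ refl
  fibre⁻ (u , e₁ , v , e₂ , w) _ | there (there (there (here x∈)))
    with _ , _ , here refl , here refl , refl ←
           ∈-tuplesOn⁻ (old u) (clone v) (old w) [ cloneEdge e₁ v ] [ cloneEdge e₂ v ] x∈
    = clone-v refl refl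

  fibre-unique : ∀ y → Unique (fibre y)
  fibre-unique (u , e₁ , v , e₂ , w) = Unique.concat⁺
    (  tuplesOn-unique _ !F₁ !F₂
     ∷ tuplesOn-unique _ !single !F₂
     ∷ tuplesOn-unique _ !F₁ !single
     ∷ tuplesOn-unique _ !single !single
     ∷ [])
    (  (  tuplesOn-disjoint (old≢clone ∘ cong proj₁)
        ∷ tuplesOn-disjoint (old≢clone ∘ cong (proj₂ ∘ proj₂))
        ∷ tuplesOn-disjoint (old≢clone ∘ cong (proj₁ ∘ proj₂))
        ∷ [])
     ∷ (  tuplesOn-disjoint (old≢clone ∘ sym ∘ cong proj₁)
        ∷ tuplesOn-disjoint (old≢clone ∘ sym ∘ cong proj₁)
        ∷ [])
     ∷ (tuplesOn-disjoint (old≢clone ∘ sym ∘ cong (proj₂ ∘ proj₂)) ∷ [])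
     ∷ []
     ∷ [])
    where
    !F₁ = edgeFibre-unique e₁ u v
    !F₂ = edgeFibre-unique e₂ v w
    !single : ∀ {f} → Unique [ f ]
    !single = [] ∷ []

  collapse-injective-over : EdgeOver e f → ∀ z z′ → z ∈ₛ f → z′ ∈ₛ f → collapse z ≡ collapse z′ → z ≡ z′
  collapse-injective-over ov z z′ z∈ z′∈ eq with collapse z | origin z | collapse z′ | origin z′
  ... | _ | is-old a   | _ | is-old b   = cong old eq
  ... | _ | is-clone a | _ | is-clone b = cong clone eq
  ... | _ | is-old a   | _ | is-clone b with refl ← eq = ⊥-elim (old∈⇒clone∉ ov z∈ z′∈)
  ... | _ | is-clone a | _ | is-old b   with refl ← eq = ⊥-elim (old∈⇒clone∉ ov z′∈ z∈)

  clone-unique-over : EdgeOver e f → clone a ∈ₛ f → clone b ∈ₛ f → a ≡ b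
  clone-unique-over ov a∈f b∈f with refl ← clone∈⇒≡cloneEdge ov a∈f = sym (clone∈cloneEdge⁻ b∈f)

  collapseTuple-≡ : ∀ {u′ v′ w′} → collapse u′ ≡ u → collapseEdge f₁ ≡ e₁ → collapse v′ ≡ v →
                    collapseEdge f₂ ≡ e₂ → collapse w′ ≡ w →
                    collapseTuple (u′ , f₁ , v′ , f₂ , w′) ≡ (u , e₁ , v , e₂ , w)
  collapseTuple-≡ refl refl refl refl refl = refl

  collapse-FibreView : u ∈ₛ e₁ → v ∈ₛ e₁ → v ∈ₛ e₂ → w ∈ₛ e₂ →
                       ∀ {x} → FibreView (u , e₁ , v , e₂ , w) x → collapseTuple x ≡ (u , e₁ , v , e₂ , w)
  collapse-FibreView {u} {v = v} {w = w} u∈₁ v∈₁ v∈₂ w∈₂ (no-clone f₁∈ f₂∈) =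
    collapseTuple-≡ (collapse-old u) (collapseEdge-over (proj₁ (edgeFibre⁻ u∈₁ v∈₁ f₁∈)))
      (collapse-old v) (collapseEdge-over (proj₁ (edgeFibre⁻ v∈₂ w∈₂ f₂∈))) (collapse-old w)
  collapse-FibreView {u} {v = v} {w = w} u∈₁ v∈₁ v∈₂ w∈₂ (clone-u refl f₂∈) =
    collapseTuple-≡ (collapse-clone u) (collapseEdge-over (is-clone u∈₁))
      (collapse-old v) (collapseEdge-over (proj₁ (edgeFibre⁻ v∈₂ w∈₂ f₂∈))) (collapse-old w)
  collapse-FibreView {u} {v = v} {w = w} u∈₁ v∈₁ v∈₂ w∈₂ (clone-w f₁∈ refl) =
    collapseTuple-≡ (collapse-old u) (collapseEdge-over (proj₁ (edgeFibre⁻ u∈₁ v∈₁ f₁∈)))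
      (collapse-old v) (collapseEdge-over (is-clone w∈₂)) (collapse-clone w)
  collapse-FibreView {u} {v = v} {w = w} u∈₁ v∈₁ v∈₂ w∈₂ (clone-v refl refl) =
    collapseTuple-≡ (collapse-old u) (collapseEdge-over (is-clone v∈₁))
      (collapse-clone v) (collapseEdge-over (is-clone v∈₂)) (collapse-old w)

  length-fibre : u ∈ₛ e₁ → v ∈ₛ e₁ → v ∈ₛ e₂ → w ∈ₛ e₂ → u ≢ v → v ≢ w →
                 length (fibre (u , e₁ , v , e₂ , w)) ≡ ∣ e₁ ∣ * ∣ e₂ ∣
  length-fibre {u} {e₁} {v} {e₂} {w} u∈₁ v∈₁ v∈₂ w∈₂ u≢v v≢w = begin
    length (fibre (u , e₁ , v , e₂ , w))       ≡⟨ length-concat (fibreBlocks (u , e₁ , v , e₂ , w)) ⟩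
    sum (map length (fibreBlocks (u , e₁ , v , e₂ , w)))
      ≡⟨ cong₂ _+_ (length-tuplesOn _ F₁ F₂) (cong₂ _+_ (length-tuplesOn _ [ _ ] F₂)
           (cong₂ _+_ (length-tuplesOn _ F₁ [ _ ]) (cong (_+ 0) (length-tuplesOn _ [ _ ] [ _ ])))) ⟩
    l₁ * l₂ + (1 * l₂ + (l₁ * 1 + (1 * 1 + 0)))  ≡⟨ expand l₁ l₂ ⟩
    suc l₁ * suc l₂
      ≡⟨ cong₂ _*_ (length-edgeFibre u∈₁ v∈₁ u≢v) (length-edgeFibre v∈₂ w∈₂ v≢w) ⟩
    ∣ e₁ ∣ * ∣ e₂ ∣                              ∎
    where
    open ≡-Reasoning
    F₁ = edgeFibre e₁ u v
    F₂ = edgeFibre e₂ v w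
    l₁ = length F₁
    l₂ = length F₂
    expand : ∀ a b → a * b + (1 * b + (a * 1 + (1 * 1 + 0))) ≡ suc a * suc b
    expand = solve-∀

-- One ILTH step

module _ {n : ℕ} (E : List (Subset n)) where

  open CloneStep n

  private
    H H′ : Hypergraph
    H  = hg n E
    H′ = ILTH-step H
    E′ = edges H′

  ∈-step⁻ : ∀ {f} → f ∈ E′ → ∃[ e ] e ∈ E × EdgeOver e f
  ∈-step⁻ f∈ with ∈-++⁻ (map oldEdge E) f∈
  ... | inj₁ f∈old with e , e∈ , refl ← ∈-map⁻ oldEdge f∈old = e , e∈ , is-old
  ... | inj₂ f∈clone
    with e , e∈ , f∈e ← find (∈-concatMap⁻ (λ e → map (cloneEdge e) (members e)) {xs = E} f∈clone)
    with a , a∈ , refl ← ∈-map⁻ (cloneEdge e) f∈e = e , e∈ , is-clone (∈-members⁻ a∈)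

  ∈-step⁺ : ∀ {e f} → e ∈ E → EdgeOver e f → f ∈ E′
  ∈-step⁺ e∈ is-old = ∈-++⁺ˡ (∈-map⁺ oldEdge e∈)
  ∈-step⁺ {e} e∈ (is-clone a∈) =
    ∈-++⁺ʳ (map oldEdge E) (∈-concatMap⁺ _ (lose e∈ (∈-map⁺ (cloneEdge e) (∈-members⁺ a∈))))

  over-collapseEdge : ∀ {f} → f ∈ E′ → EdgeOver (collapseEdge f) f
  over-collapseEdge {f} f∈ = let _ , _ , ov = ∈-step⁻ f∈ in
    subst (λ e → EdgeOver e f) (sym (collapseEdge-over ov)) ov

  collapseEdge-∈ : ∀ {f} → f ∈ E′ → collapseEdge f ∈ E
  collapseEdge-∈ f∈ = let e , e∈ , ov = ∈-step⁻ f∈ in subst (_∈ E) (sym (collapseEdge-over ov)) e∈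

  collapse-∈ : ∀ {f z} → f ∈ E′ → z ∈ₛ f → collapse z ∈ₛ collapseEdge f
  collapse-∈ f∈ = collapse-∈-over (over-collapseEdge f∈) _

  collapse-injective : ∀ {f z z′} → f ∈ E′ → z ∈ₛ f → z′ ∈ₛ f → collapse z ≡ collapse z′ → z ≡ z′
  collapse-injective f∈ = collapse-injective-over (over-collapseEdge f∈) _ _

  clone-unique : ∀ {f a b} → f ∈ E′ → clone a ∈ₛ f → clone b ∈ₛ f → a ≡ b
  clone-unique f∈ = clone-unique-over (over-collapseEdge f∈)

  ∈-edgeFibre-collapse : ∀ {f u v} → f ∈ E′ → old u ∈ₛ f → old v ∈ₛ f → f ∈ edgeFibre (collapseEdge f) u v
  ∈-edgeFibre-collapse f∈ = edgeFibre⁺ (over-collapseEdge f∈)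

  ≡cloneEdge-collapse : ∀ {f a} → f ∈ E′ → clone a ∈ₛ f → f ≡ cloneEdge (collapseEdge f) a
  ≡cloneEdge-collapse f∈ = clone∈⇒≡cloneEdge (over-collapseEdge f∈)

  Triangle-collapse : ∀ x → Triangle E′ x → Triangle E (collapseTuple x)
  Triangle-collapse _ (f₁∈ , f₂∈ , u∈₁ , v∈₁ , v∈₂ , w∈₂ , third) =
    collapseEdge-∈ f₁∈ , collapseEdge-∈ f₂∈ , collapse-∈ f₁∈ u∈₁ , collapse-∈ f₁∈ v∈₁ ,
    collapse-∈ f₂∈ v∈₂ , collapse-∈ f₂∈ w∈₂ ,
    (let _ , f₃∈ , u∈₃ , w∈₃ = find third
     in lose (collapseEdge-∈ f₃∈) (collapse-∈ f₃∈ u∈₃ , collapse-∈ f₃∈ w∈₃))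

  InA-collapse : ∀ x → InA H′ x → InA H (collapseTuple x)
  InA-collapse x@(_ , _ , _ , _ , _)
               (u≢v , v≢w , u≢w , triangle@(f₁∈ , f₂∈ , u∈₁ , v∈₁ , v∈₂ , w∈₂ , third)) =
    InA⁺ H (collapseTuple x)
      ( u≢v ∘ collapse-injective f₁∈ u∈₁ v∈₁
      , v≢w ∘ collapse-injective f₂∈ v∈₂ w∈₂
      , (let _ , f₃∈ , u∈₃ , w∈₃ = find third in u≢w ∘ collapse-injective f₃∈ u∈₃ w∈₃))
      (Triangle-collapse x triangle)

  fibre-complete : ∀ x → InA H′ x → FibreView (collapseTuple x) x
  fibre-complete (u′ , f₁ , v′ , f₂ , w′)
                 (u′≢v′ , v′≢w′ , u′≢w′ , f₁∈ , f₂∈ , u′∈₁ , v′∈₁ , v′∈₂ , w′∈₂ , third)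
    with collapse u′ | origin u′ | collapse v′ | origin v′ | collapse w′ | origin w′
  ... | _ | is-old u   | _ | is-old v   | _ | is-old w   =
    no-clone (∈-edgeFibre-collapse f₁∈ u′∈₁ v′∈₁) (∈-edgeFibre-collapse f₂∈ v′∈₂ w′∈₂)
  ... | _ | is-clone u | _ | is-old v   | _ | is-old w   =
    clone-u (≡cloneEdge-collapse f₁∈ u′∈₁) (∈-edgeFibre-collapse f₂∈ v′∈₂ w′∈₂)
  ... | _ | is-old u   | _ | is-old v   | _ | is-clone w =
    clone-w (∈-edgeFibre-collapse f₁∈ u′∈₁ v′∈₁) (≡cloneEdge-collapse f₂∈ w′∈₂)
  ... | _ | is-old u   | _ | is-clone v | _ | is-old w   =
    clone-v (≡cloneEdge-collapse f₁∈ v′∈₁) (≡cloneEdge-collapse f₂∈ v′∈₂)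
  ... | _ | is-clone u | _ | is-clone v | _ | _          =
    ⊥-elim (u′≢v′ (cong clone (clone-unique f₁∈ u′∈₁ v′∈₁)))
  ... | _ | _          | _ | is-clone v | _ | is-clone w =
    ⊥-elim (v′≢w′ (cong clone (clone-unique f₂∈ v′∈₂ w′∈₂)))
  ... | _ | is-clone u | _ | is-old v   | _ | is-clone w =
    let _ , f₃∈ , u′∈₃ , w′∈₃ = find third in ⊥-elim (u′≢w′ (cong clone (clone-unique f₃∈ u′∈₃ w′∈₃)))

  lift-third : ∀ {u w u′ w′} → Any (λ e → u ∈ₛ e × w ∈ₛ e) E →
               (∀ {e} → u ∈ₛ e → w ∈ₛ e → ∃[ f ] EdgeOver e f × u′ ∈ₛ f × w′ ∈ₛ f) →
               Any (λ f → u′ ∈ₛ f × w′ ∈ₛ f) E′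
  lift-third third lift =
    let _ , e∈ , u∈ , w∈ = find third
        _ , ov , u′∈ , w′∈ = lift u∈ w∈
    in lose (∈-step⁺ e∈ ov) (u′∈ , w′∈)

  fibre-Triangle : ∀ {y x} → InA H y → FibreView y x → Triangle E′ x
  fibre-Triangle (_ , _ , _ , e₁∈ , e₂∈ , u∈₁ , v∈₁ , v∈₂ , w∈₂ , third) (no-clone f₁∈ f₂∈) =
    let ov₁ , u∈f₁ , v∈f₁ = edgeFibre⁻ u∈₁ v∈₁ f₁∈
        ov₂ , v∈f₂ , w∈f₂ = edgeFibre⁻ v∈₂ w∈₂ f₂∈
    in ∈-step⁺ e₁∈ ov₁ , ∈-step⁺ e₂∈ ov₂ , u∈f₁ , v∈f₁ , v∈f₂ , w∈f₂ ,
       lift-third third (λ u∈ w∈ → _ , is-old , old∈oldEdge u∈ , old∈oldEdge w∈)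
  fibre-Triangle (u≢v , _ , u≢w , e₁∈ , e₂∈ , u∈₁ , v∈₁ , v∈₂ , w∈₂ , third) (clone-u refl f₂∈) =
    let ov₂ , v∈f₂ , w∈f₂ = edgeFibre⁻ v∈₂ w∈₂ f₂∈
    in ∈-step⁺ e₁∈ (is-clone u∈₁) , ∈-step⁺ e₂∈ ov₂ , clone∈cloneEdge , old∈cloneEdge⁺ v∈₁ (≢-sym u≢v) ,
       v∈f₂ , w∈f₂ ,
       lift-third third (λ u∈ w∈ → _ , is-clone u∈ , clone∈cloneEdge , old∈cloneEdge⁺ w∈ (≢-sym u≢w))
  fibre-Triangle (_ , v≢w , u≢w , e₁∈ , e₂∈ , u∈₁ , v∈₁ , v∈₂ , w∈₂ , third) (clone-w f₁∈ refl) =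
    let ov₁ , u∈f₁ , v∈f₁ = edgeFibre⁻ u∈₁ v∈₁ f₁∈
    in ∈-step⁺ e₁∈ ov₁ , ∈-step⁺ e₂∈ (is-clone w∈₂) , u∈f₁ , v∈f₁ ,
       old∈cloneEdge⁺ v∈₂ v≢w , clone∈cloneEdge ,
       lift-third third (λ u∈ w∈ → _ , is-clone w∈ , old∈cloneEdge⁺ u∈ u≢w , clone∈cloneEdge)
  fibre-Triangle (u≢v , v≢w , _ , e₁∈ , e₂∈ , u∈₁ , v∈₁ , v∈₂ , w∈₂ , third) (clone-v refl refl) =
    ∈-step⁺ e₁∈ (is-clone v∈₁) , ∈-step⁺ e₂∈ (is-clone v∈₂) , old∈cloneEdge⁺ u∈₁ u≢v , clone∈cloneEdge ,
    clone∈cloneEdge , old∈cloneEdge⁺ w∈₂ (≢-sym v≢w) ,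
    lift-third third (λ u∈ w∈ → _ , is-old , old∈oldEdge u∈ , old∈oldEdge w∈)

  collapse-fibre : ∀ {y x} → y ∈ A H → x ∈ fibre y → collapseTuple x ≡ y
  collapse-fibre {y@(_ , _ , _ , _ , _)} y∈ x∈ with ∈-A⁻ H y∈
  ... | _ , _ , _ , _ , _ , u∈₁ , v∈₁ , v∈₂ , w∈₂ , _ = collapse-FibreView u∈₁ v∈₁ v∈₂ w∈₂ (fibre⁻ y x∈)

  fibre⊆A : ∀ {y x} → y ∈ A H → x ∈ fibre y → InA H′ x
  fibre⊆A {y@(_ , _ , _ , _ , _)} {x} y∈ x∈ with ∈-A⁻ H y∈
  ... | iy@(u≢v , v≢w , u≢w , _) =
    InA⁺ H′ x (Distinct-collapse⁻ x (subst Distinct (sym (collapse-fibre y∈ x∈)) (u≢v , v≢w , u≢w)))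
      (fibre-Triangle iy (fibre⁻ y x∈))

  A-step↭ : A H′ ↭ concatMap fibre (A H)
  A-step↭ = ∼bag⇒↭ (unique∧set⇒bag (A-unique H′)
    (concatMap-unique collapseTuple (A-unique H) (λ _ → fibre-unique _) collapse-fibre)
    (mk⇔ to from))
    where
    to : ∀ {x} → x ∈ A H′ → x ∈ concatMap fibre (A H)
    to {x} x∈ = let ix = ∈-A⁻ H′ x∈ in
      ∈-concatMap⁺ fibre (lose (∈-A⁺ H (InA-collapse x ix)) (fibre⁺ (fibre-complete x ix)))
    from : ∀ {x} → x ∈ concatMap fibre (A H) → x ∈ A H′
    from x∈ = let _ , y∈ , x∈fy = find (∈-concatMap⁻ fibre x∈) in ∈-A⁺ H′ (fibre⊆A y∈ x∈fy)

  uniform-step : ∀ {k} → Uniform k H → Uniform k H′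
  uniform-step U = All.tabulate λ f∈ →
    let _ , e∈ , ov = ∈-step⁻ f∈ in trans (∣over∣≡∣e∣ ov) (All.lookup U e∈)

  ∣A∣-step : ∀ {k} → Uniform k H → ∣A∣ H′ ≡ k * k * ∣A∣ H
  ∣A∣-step {k} U = begin
    length (A H′)                   ≡⟨ ↭-length A-step↭ ⟩
    length (concatMap fibre (A H))  ≡⟨ length-concatMap-const (k * k) (A H) (All.tabulate length-fibre-A) ⟩
    length (A H) * (k * k)          ≡⟨ *-comm (length (A H)) (k * k) ⟩
    k * k * length (A H)            ∎
    where
    open ≡-Reasoning
    length-fibre-A : ∀ {y} → y ∈ A H → length (fibre y) ≡ k * k
    length-fibre-A {_ , e₁ , _ , e₂ , _} y∈ with ∈-A⁻ H y∈
    ... | u≢v , v≢w , _ , e₁∈ , e₂∈ , u∈₁ , v∈₁ , v∈₂ , w∈₂ , _ =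
      trans (length-fibre u∈₁ v∈₁ v∈₂ w∈₂ u≢v v≢w) (cong₂ _*_ (All.lookup U e₁∈) (All.lookup U e₂∈))

ILTH-uniform : ∀ {k} t (H : Hypergraph) → Uniform k H → Uniform k (ILTH t H)
ILTH-uniform zero    H U = U
ILTH-uniform (suc t) H U = uniform-step (edges (ILTH t H)) (ILTH-uniform t H U)

lemma14 : (k : ℕ) → 2 ≤ k → (H₀ : Hypergraph) → Uniform k H₀ →
          (t : ℕ) → ∣A∣ (ILTH t H₀) ≡ (k * k) ^ t * ∣A∣ H₀
lemma14 k _ H₀ U zero    = sym (*-identityˡ (∣A∣ H₀))
lemma14 k k≥2 H₀ U (suc t) = begin
  ∣A∣ (ILTH-step (ILTH t H₀))      ≡⟨ ∣A∣-step (edges (ILTH t H₀)) (ILTH-uniform t H₀ U) ⟩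
  k * k * ∣A∣ (ILTH t H₀)          ≡⟨ cong (k * k *_) (lemma14 k k≥2 H₀ U t) ⟩
  k * k * ((k * k) ^ t * ∣A∣ H₀)   ≡⟨ *-assoc (k * k) ((k * k) ^ t) (∣A∣ H₀) ⟨
  (k * k) ^ suc t * ∣A∣ H₀         ∎
  where open ≡-Reasoning
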